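{- Let $d,r\in\mathbb{N}$ and let $\Gamma\le\mathrm{Aut}(\mathbb{L}^d)$, with minimum displacement $D(\Gamma)$. Then (i) $\mathbb{L}^d/\Gamma$ is $r$-locally $\mathbb{L}^d$ if and only if $D(\Gamma)\ge 2r+2$; (ii) $\mathbb{L}^d/\Gamma$ is weakly $r$-locally $\mathbb{L}^d$ if and only if $D(\Gamma)\ge 2r+1$.
   Context: $\mathbb{L}^d$ is the graph with vertex set $\mathbb{Z}^d$ and edges $\{x,x+e_i\}$. For $\Gamma\le\mathrm{Aut}(F)$, the quotient (multi)graph $F/\Gamma$ has as vertices the $\Gamma$-orbits of $V(F)$ and as edges the $\Gamma$-orbits of $E(F)$, the orbit of $\{x,y\}$ joining the orbits of $x$ and $y$. $D(\Gamma)=\min\{d_F(x,\gamma(x)): x\in V(F),\ \gamma\in\Gamma\setminus\{\mathrm{Id}\}\}$ (graph distance). For a graph $G$ and vertex $v$, $\mathrm{Link}_r(v,G)$ is the subgraph induced by vertices at distance at most $r$ from $v$, and $\mathrm{Link}^-_r(v,G)$ is $\mathrm{Link}_r(v,G)$ minus the edges both of whose endpoints are at distance exactly $r$ from $v$. $G$ is $r$-locally $\mathbb{L}^d$ (resp. weakly $r$-locally $\mathbb{L}^d$) if for every vertex $v$ there is a graph isomorphism $\mathrm{Link}_r(0,\mathbb{L}^d)\to\mathrm{Link}_r(v,G)$ (resp. $\mathrm{Link}^-_r(0,\mathbb{L}^d)\to\mathrm{Link}^-_r(v,G)$) sending $0$ to $v$. -}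

module Defs where

open import Data.Nat using (ℕ; zero; suc; _≤_)
open import Data.Integer using (ℤ; 0ℤ) renaming (suc to sucℤ)
open import Data.Fin using (Fin)
open import Data.Vec using (Vec; updateAt; replicate)
open import Data.Product using (Σ; ∃; _×_; _,_; proj₁)
open import Data.Sum using (_⊎_)
open import Relation.Nullary using (¬_)
open import Relation.Binary.PropositionalEquality using (_≡_)
open import Function.Bundles using (_↔_; Inverse; _⇔_)

record MGraph : Set₁ where
  field
    V    : Set
    _≈_  : V → V → Set
    E    : Set
    _≈ₑ_ : E → E → Set
    Inc  : E → V → V → Set

open MGraph public

Walk : (G : MGraph) → V G → V G → ℕ → Set
Walk G u v zero    = _≈_ G u v
Walk G u v (suc n) = Σ (E G) λ e → Σ (V G) λ w → Inc G e u w × Walk G w v n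

DistLe : (G : MGraph) → V G → V G → ℕ → Set
DistLe G u v r = Σ ℕ λ n → n ≤ r × Walk G u v n

DistGe : (G : MGraph) → V G → V G → ℕ → Set
DistGe G u v k = ∀ n → Walk G u v n → k ≤ n

DistEq : (G : MGraph) → V G → V G → ℕ → Set
DistEq G u v r = DistLe G u v r × DistGe G u v r

Sub : (G : MGraph) → (V G → Set) → (E G → Set) → MGraph
Sub G P Q = record
  { V    = Σ (V G) P
  ; _≈_  = λ a b → _≈_ G (proj₁ a) (proj₁ b)
  ; E    = Σ (E G) Q
  ; _≈ₑ_ = λ a b → _≈ₑ_ G (proj₁ a) (proj₁ b)
  ; Inc  = λ e a b → Inc G (proj₁ e) (proj₁ a) (proj₁ b)
  }

EdgeInBall : (G : MGraph) → V G → ℕ → E G → Set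
EdgeInBall G v r e = ∀ a b → Inc G e a b → DistLe G v a r × DistLe G v b r

EdgeOnSphere : (G : MGraph) → V G → ℕ → E G → Set
EdgeOnSphere G v r e = Σ (V G) λ a → Σ (V G) λ b →
  Inc G e a b × DistEq G v a r × DistEq G v b r

Link : (G : MGraph) → V G → ℕ → MGraph
Link G v r = Sub G (λ u → DistLe G v u r) (EdgeInBall G v r)

Link⁻ : (G : MGraph) → V G → ℕ → MGraph
Link⁻ G v r = Sub G (λ u → DistLe G v u r)
                    (λ e → EdgeInBall G v r e × ¬ EdgeOnSphere G v r e)

record Iso (G H : MGraph) : Set where
  field
    fV      : V G → V H
    fV-cong : ∀ {a b} → _≈_ G a b → _≈_ H (fV a) (fV b)
    fV-inj  : ∀ {a b} → _≈_ H (fV a) (fV b) → _≈_ G a b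
    fV-surj : ∀ c → Σ (V G) λ a → _≈_ H (fV a) c
    fE      : E G → E H
    fE-cong : ∀ {e f} → _≈ₑ_ G e f → _≈ₑ_ H (fE e) (fE f)
    fE-inj  : ∀ {e f} → _≈ₑ_ H (fE e) (fE f) → _≈ₑ_ G e f
    fE-surj : ∀ g → Σ (E G) λ e → _≈ₑ_ H (fE e) g
    inc     : ∀ e a b → Inc G e a b → Inc H (fE e) (fV a) (fV b)
    inc⁻    : ∀ e a b → Inc H (fE e) (fV a) (fV b) → Inc G e a b

PointedLinkIso : (G H : MGraph) (u : V G) (v : V H) (r : ℕ) → Set
PointedLinkIso G H u v r = Σ (Iso (Link G u r) (Link H v r)) λ φ →
  ∀ (c : V (Link G u r)) → _≈_ G (proj₁ c) u →
    _≈_ H (proj₁ (Iso.fV φ c)) v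

PointedLink⁻Iso : (G H : MGraph) (u : V G) (v : V H) (r : ℕ) → Set
PointedLink⁻Iso G H u v r = Σ (Iso (Link⁻ G u r) (Link⁻ H v r)) λ φ →
  ∀ (c : V (Link⁻ G u r)) → _≈_ G (proj₁ c) u →
    _≈_ H (proj₁ (Iso.fV φ c)) v

Pt : ℕ → Set
Pt d = Vec ℤ d

origin : (d : ℕ) → Pt d
origin d = replicate d 0ℤ

shift : {d : ℕ} → Pt d → Fin d → Pt d
shift x i = updateAt x i sucℤ

-- the edge (x , i) is {x , x + e_i}; every edge has exactly one such name
IncL : {d : ℕ} → Pt d × Fin d → Pt d → Pt d → Set
IncL (x , i) u v = (u ≡ x × v ≡ shift x i) ⊎ (u ≡ shift x i × v ≡ x)

𝕃 : ℕ → MGraph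
𝕃 d = record
  { V = Pt d ; _≈_ = _≡_ ; E = Pt d × Fin d ; _≈ₑ_ = _≡_ ; Inc = IncL }

Adj : {d : ℕ} → Pt d → Pt d → Set
Adj {d} x y = Σ (Pt d × Fin d) λ e → IncL e x y

record Aut (d : ℕ) : Set where
  field
    bij       : Pt d ↔ Pt d
    preserves : ∀ x y → Adj x y ⇔ Adj (Inverse.to bij x) (Inverse.to bij y)

app : {d : ℕ} → Aut d → Pt d → Pt d
app γ = Inverse.to (Aut.bij γ)

IsId : {d : ℕ} → Aut d → Set
IsId γ = ∀ x → app γ x ≡ x

-- Γ ≤ Aut(𝕃^d), given as a set of automorphisms (automorphisms compared
-- pointwise) closed under identity, composition and inverses
record IsSubgroup {d : ℕ} (Γ : Aut d → Set) : Set where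
  field
    has-id  : Σ (Aut d) λ ι → Γ ι × IsId ι
    has-∘   : ∀ α β → Γ α → Γ β →
              Σ (Aut d) λ γ → Γ γ × (∀ x → app γ x ≡ app α (app β x))
    has-inv : ∀ α → Γ α →
              Σ (Aut d) λ γ → Γ γ × (∀ x → app γ (app α x) ≡ x)

-- Quotient multigraph 𝕃^d / Γ (vertices: Γ-orbits of vertices,
-- edges: Γ-orbits of edges; represented by representatives + orbit relations)

module _ {d : ℕ} (Γ : Aut d → Set) where

  OrbV : Pt d → Pt d → Set
  OrbV x y = Σ (Aut d) λ γ → Γ γ × app γ x ≡ y

  OrbE : Pt d × Fin d → Pt d × Fin d → Set
  OrbE (x , i) (y , j) = Σ (Aut d) λ γ → Γ γ ×
    ((app γ x ≡ y × app γ (shift x i) ≡ shift y j)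
     ⊎ (app γ x ≡ shift y j × app γ (shift x i) ≡ y))

  IncQ : Pt d × Fin d → Pt d → Pt d → Set
  IncQ (x , i) u v = (OrbV x u × OrbV (shift x i) v)
                   ⊎ (OrbV (shift x i) u × OrbV x v)

  Quot : MGraph
  Quot = record
    { V = Pt d ; _≈_ = OrbV ; E = Pt d × Fin d ; _≈ₑ_ = OrbE ; Inc = IncQ }

  -- D(Γ) ≥ k : every non-identity γ ∈ Γ displaces every vertex by ≥ k
  DispGe : ℕ → Set
  DispGe k = ∀ γ → Γ γ → ¬ IsId γ → ∀ x → DistGe (𝕃 d) x (app γ x) k

LocallyL : (d r : ℕ) (G : MGraph) → Set
LocallyL d r G = ∀ v → PointedLinkIso (𝕃 d) G (origin d) v r

WeaklyLocallyL : (d r : ℕ) (G : MGraph) → Set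
WeaklyLocallyL d r G = ∀ v → PointedLink⁻Iso (𝕃 d) G (origin d) v r

module Submission where

-- Call Γ k-separated if two vertices in the same orbit at distance < k coincide. For k ≥ 3
-- this is D(Γ) ≥ k: an element of Γ fixing a vertex fixes its neighbours, hence all of 𝕃^d.
-- If Γ is (2r+1)-separated, translation to v followed by projection maps the r-ball of 𝕃^d
-- bijectively onto that of the quotient around v, edges included, except that a quotient edge
-- may join two points of the r-sphere without lifting to one edge of the ball; (2r+2)-separation
-- rules this out. Conversely, a vertex bijection of r-balls makes the projection of the r-ball
-- around any c a surjection between finite sets of the same size, so it is injective; cutting a
-- walk of length ≤ 2r at its midpoint gives (2r+1)-separation. For the full link, a walk of
-- length 2r+1 between distinct orbit-mates stays in the quotient r-ball and its image pulls
-- back to a closed walk of odd length in the bipartite graph 𝕃^d.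

open import Defs
open import Data.Empty using (⊥-elim)
open import Data.Fin as Fin using (Fin)
import Data.Fin.Properties as FinP
open import Data.Integer as ℤ using (ℤ; +_; -[1+_]; 0ℤ; ∣_∣) renaming (suc to sucℤ)
import Data.Integer.Properties as ℤP
import Data.Integer.Tactic.RingSolver as ℤS
open import Data.Nat using (ℕ; zero; suc; _≤_; _<_; _+_; _*_; _∸_; _^_; z≤n; s≤s; _≤?_; ⌊_/2⌋; ⌈_/2⌉)
open import Data.Nat.DivMod using (_mod_; m<n⇒m%n≡m)
import Data.Nat.Properties as ℕP
import Data.Nat.Tactic.RingSolver as ℕS
open import Data.Product using (Σ; ∃-syntax; _×_; _,_; proj₁; proj₂; uncurry)
open import Data.Sum using (_⊎_; inj₁; inj₂)
open import Data.Vec using ([]; _∷_; zipWith; map; lookup; tabulate)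
import Data.Vec.Properties as VecP
open import Function using (_∘_)
open import Function.Bundles using (_⇔_; mk⇔; Equivalence)
open import Relation.Binary.PropositionalEquality
open import Relation.Nullary using (¬_; yes; no)

private variable
  d : ℕ

private
  2*n≡n+n : ∀ n → 2 * n ≡ n + n
  2*n≡n+n n = cong (λ t → n + t) (ℕP.+-identityʳ n)

  m≤o⇒n≤o⇒m+n≤2*o : ∀ {m n o} → m ≤ o → n ≤ o → m + n ≤ 2 * o
  m≤o⇒n≤o⇒m+n≤2*o {m} {n} {o} m≤o n≤o = subst (m + n ≤_) (sym (2*n≡n+n o)) (ℕP.+-mono-≤ m≤o n≤o)

  m≤n⇒m<n+1 : ∀ {m n} → m ≤ n → m < n + 1
  m≤n⇒m<n+1 {m} {n} m≤n = subst (m <_) (ℕP.+-comm 1 n) (s≤s m≤n)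

  m<n+1⇒m≤n : ∀ {m} n → m < n + 1 → m ≤ n
  m<n+1⇒m≤n {m} n m<n+1 = ℕP.m<1+n⇒m≤n (subst (m <_) (ℕP.+-comm n 1) m<n+1)

data Walkᴵ (G : MGraph) : V G → V G → ℕ → Set where
  stop : ∀ {u v} → _≈_ G u v → Walkᴵ G u v 0
  step : ∀ {u w v n} (e : E G) → Inc G e u w → Walkᴵ G w v n → Walkᴵ G u v (suc n)

toWalkᴵ : ∀ {G u v} n → Walk G u v n → Walkᴵ G u v n
toWalkᴵ zero    u≈v               = stop u≈v
toWalkᴵ (suc n) (e , _ , inc , p) = step e inc (toWalkᴵ n p)

fromWalkᴵ : ∀ {G u v n} → Walkᴵ G u v n → Walk G u v n
fromWalkᴵ (stop u≈v)     = u≈v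
fromWalkᴵ (step e inc p) = e , _ , inc , fromWalkᴵ p

-- Walks and the ℓ¹ distance in 𝕃^d

infix 4 _⇝⟨_⟩_
_⇝⟨_⟩_ : {d : ℕ} → Pt d → ℕ → Pt d → Set
x ⇝⟨ n ⟩ y = Walkᴵ (𝕃 _) x y n

incL-sym : ∀ {e} {x y : Pt d} → IncL e x y → IncL e y x
incL-sym (inj₁ (p , q)) = inj₂ (q , p)
incL-sym (inj₂ (p , q)) = inj₁ (q , p)

infixr 5 _++ᵂ_
_++ᵂ_ : ∀ {x y z : Pt d} {m n} → x ⇝⟨ m ⟩ y → y ⇝⟨ n ⟩ z → x ⇝⟨ m + n ⟩ z
stop refl    ++ᵂ q = q
step e inc p ++ᵂ q = step e inc (p ++ᵂ q)

snoc : ∀ {x y z : Pt d} {e n} → x ⇝⟨ n ⟩ y → IncL e y z → x ⇝⟨ suc n ⟩ z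
snoc {e = e} (stop refl)    inc′ = step e inc′ (stop refl)
snoc         (step e inc p) inc′ = step e inc (snoc p inc′)

reverse : ∀ {x y : Pt d} {n} → x ⇝⟨ n ⟩ y → y ⇝⟨ n ⟩ x
reverse (stop refl)    = stop refl
reverse (step e inc p) = snoc (reverse p) (incL-sym inc)

splitAt : ∀ {x y : Pt d} m {n} → x ⇝⟨ m + n ⟩ y → ∃[ w ] x ⇝⟨ m ⟩ w × w ⇝⟨ n ⟩ y
splitAt zero    p              = _ , stop refl , p
splitAt (suc m) (step e inc p) with w , p₁ , p₂ ← splitAt m p = w , step e inc p₁ , p₂

dist : Pt d → Pt d → ℕ
dist []      []      = 0
dist (a ∷ x) (b ∷ y) = ∣ a ℤ.- b ∣ + dist x y

private
  ∣suc∣-step : ∀ z → ∣ sucℤ z ∣ ≡ suc ∣ z ∣ ⊎ ∣ z ∣ ≡ suc ∣ sucℤ z ∣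
  ∣suc∣-step (+ n)    = inj₁ refl
  ∣suc∣-step -[1+ n ] = inj₂ (cong suc (sym (trans (cong ∣_∣ (ℤP.1-[1+n]≡-n n)) (ℤP.∣-i∣≡∣i∣ (+ n)))))

dist-shift : (x y : Pt d) (i : Fin d) →
             dist (shift x i) y ≡ suc (dist x y) ⊎ dist x y ≡ suc (dist (shift x i) y)
dist-shift (a ∷ x) (b ∷ y) Fin.zero with ∣suc∣-step (a ℤ.- b)
... | inj₁ e = inj₁ (cong (_+ dist x y) (trans (cong ∣_∣ (ℤP.+-assoc (+ 1) a (ℤ.- b))) e))
... | inj₂ e = inj₂ (cong (_+ dist x y) (trans e (cong (λ t → suc ∣ t ∣) (sym (ℤP.+-assoc (+ 1) a (ℤ.- b))))))
dist-shift (a ∷ x) (b ∷ y) (Fin.suc i) with dist-shift x y i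
... | inj₁ e = inj₁ (trans (cong (λ t → ∣ a ℤ.- b ∣ + t) e) (ℕP.+-suc _ _))
... | inj₂ e = inj₂ (trans (cong (λ t → ∣ a ℤ.- b ∣ + t) e) (ℕP.+-suc _ _))

dist-step : ∀ {e} {x y : Pt d} (c : Pt d) → IncL e x y →
            dist y c ≡ suc (dist x c) ⊎ dist x c ≡ suc (dist y c)
dist-step {e = x , i} c (inj₁ (refl , refl)) = dist-shift x c i
dist-step {e = x , i} c (inj₂ (refl , refl)) with dist-shift x c i
... | inj₁ e = inj₂ e
... | inj₂ e = inj₁ e

dist-self : (x : Pt d) → dist x x ≡ 0
dist-self []      = refl
dist-self (a ∷ x) = cong₂ _+_ (cong ∣_∣ (ℤP.+-inverseʳ a)) (dist-self x)

length≡dist+even : ∀ {x y : Pt d} {n} → x ⇝⟨ n ⟩ y → ∃[ k ] n ≡ dist x y + 2 * k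
length≡dist+even {y = y} (stop refl) = 0 , sym (trans (ℕP.+-identityʳ _) (dist-self y))
length≡dist+even {x = x} {y} (step {w = w} {n = n} e inc p) with length≡dist+even p | dist-step y inc
... | k , n≡ | inj₁ farther = suc k , (begin
  suc n                            ≡⟨ cong suc n≡ ⟩
  suc (dist w y + 2 * k)           ≡⟨ cong (λ t → suc (t + 2 * k)) farther ⟩
  suc (suc (dist x y) + 2 * k)     ≡⟨ two-more (dist x y) k ⟩
  dist x y + 2 * suc k             ∎)
  where
  open ≡-Reasoning
  two-more : ∀ D k → suc (suc D + 2 * k) ≡ D + 2 * suc k
  two-more = ℕS.solve-∀
... | k , n≡ | inj₂ closer = k , trans (cong suc n≡) (cong (_+ 2 * k) (sym closer))

dist≤length : ∀ {x y : Pt d} {n} → x ⇝⟨ n ⟩ y → dist x y ≤ n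
dist≤length p with k , n≡ ← length≡dist+even p = subst (_ ≤_) (sym n≡) (ℕP.m≤m+n _ _)

no-odd-closed-walk : ∀ {x : Pt d} s → ¬ (x ⇝⟨ 2 * s + 1 ⟩ x)
no-odd-closed-walk {x = x} s p with k , n≡ ← length≡dist+even p =
  ℕP.even≢odd k s (sym (trans (ℕP.+-comm 1 (2 * s)) (trans n≡ (cong (_+ 2 * k) (dist-self x)))))

private
  walk-in-tail : (b : ℤ) {x y : Pt d} {n : ℕ} → x ⇝⟨ n ⟩ y → (b ∷ x) ⇝⟨ n ⟩ (b ∷ y)
  walk-in-tail b (stop refl) = stop refl
  walk-in-tail b (step (p , i) (inj₁ (refl , refl)) q) =
    step (b ∷ p , Fin.suc i) (inj₁ (refl , refl)) (walk-in-tail b q)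
  walk-in-tail b (step (p , i) (inj₂ (refl , refl)) q) =
    step (b ∷ p , Fin.suc i) (inj₂ (refl , refl)) (walk-in-tail b q)

  climb : ∀ m a (x : Pt d) → (a ∷ x) ⇝⟨ m ⟩ ((a ℤ.+ + m) ∷ x)
  climb zero    a x = subst (λ c → (a ∷ x) ⇝⟨ 0 ⟩ (c ∷ x)) (sym (ℤP.+-identityʳ a)) (stop refl)
  climb (suc m) a x = step (a ∷ x , Fin.zero) (inj₁ (refl , refl))
    (subst (λ c → (sucℤ a ∷ x) ⇝⟨ m ⟩ (c ∷ x)) (reassoc a (+ m)) (climb m (sucℤ a) x))
    where
    reassoc : ∀ a m → (ℤ.1ℤ ℤ.+ a) ℤ.+ m ≡ a ℤ.+ (ℤ.1ℤ ℤ.+ m)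
    reassoc = ℤS.solve-∀

  walk-in-head : ∀ a b (x : Pt d) → (a ∷ x) ⇝⟨ ∣ a ℤ.- b ∣ ⟩ (b ∷ x)
  walk-in-head a b x with a ℤ.- b in eq
  ... | + m      = subst (λ c → (c ∷ x) ⇝⟨ m ⟩ (b ∷ x))
                     (trans (cong (λ t → b ℤ.+ t) (sym eq)) (cancel b a)) (reverse (climb m b x))
    where
    cancel : ∀ b a → b ℤ.+ (a ℤ.- b) ≡ a
    cancel = ℤS.solve-∀
  ... | -[1+ m ] = subst (λ c → (a ∷ x) ⇝⟨ suc m ⟩ (c ∷ x))
                     (trans (cong (λ t → a ℤ.+ ℤ.- t) (sym eq)) (cancel a b)) (climb (suc m) a x)
    where
    cancel : ∀ a b → a ℤ.+ ℤ.- (a ℤ.- b) ≡ b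
    cancel = ℤS.solve-∀

geodesic : (x y : Pt d) → x ⇝⟨ dist x y ⟩ y
geodesic []      []      = stop refl
geodesic (a ∷ x) (b ∷ y) = walk-in-head a b x ++ᵂ walk-in-tail b (geodesic x y)

distLe⇔dist≤ : ∀ {x y : Pt d} {r} → DistLe (𝕃 d) x y r ⇔ dist x y ≤ r
distLe⇔dist≤ {x = x} {y} = mk⇔
  (λ (n , n≤r , p) → ℕP.≤-trans (dist≤length (toWalkᴵ n p)) n≤r)
  (λ d≤r → dist x y , d≤r , fromWalkᴵ (geodesic x y))

distGe⇔≤dist : ∀ {x y : Pt d} {r} → DistGe (𝕃 d) x y r ⇔ r ≤ dist x y
distGe⇔≤dist {x = x} {y} = mk⇔
  (λ ge → ge (dist x y) (fromWalkᴵ (geodesic x y)))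
  (λ r≤d n p → ℕP.≤-trans r≤d (dist≤length (toWalkᴵ n p)))

adjacent-dist : ∀ {e} (c : Pt d) {a b : Pt d} → IncL e a b → dist c b ≤ suc (dist c a)
adjacent-dist c {a} inc = dist≤length (snoc (geodesic c a) inc)

edgeInBall𝕃⇔ : ∀ {c : Pt d} {r x i} →
               EdgeInBall (𝕃 d) c r (x , i) ⇔ (DistLe (𝕃 d) c x r × DistLe (𝕃 d) c (shift x i) r)
edgeInBall𝕃⇔ {d = d} {c = c} {r} {x} {i} = mk⇔ (λ e∈B → e∈B x (shift x i) (inj₁ (refl , refl))) ends⇒edge
  where
  ends⇒edge : DistLe (𝕃 d) c x r × DistLe (𝕃 d) c (shift x i) r → EdgeInBall (𝕃 d) c r (x , i)
  ends⇒edge (x∈B , sx∈B) _ _ (inj₁ (refl , refl)) = x∈B , sx∈B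
  ends⇒edge (x∈B , sx∈B) _ _ (inj₂ (refl , refl)) = sx∈B , x∈B

incL-ends : ∀ {w : Pt d} {j a b} (P : Pt d → Set) → IncL (w , j) a b → P a → P b → P w × P (shift w j)
incL-ends P (inj₁ (refl , refl)) Pa Pb = Pa , Pb
incL-ends P (inj₂ (refl , refl)) Pa Pb = Pb , Pa

coordSum : Pt d → ℤ
coordSum []      = 0ℤ
coordSum (a ∷ x) = a ℤ.+ coordSum x

coordSum-shift : (x : Pt d) (i : Fin d) → coordSum (shift x i) ≡ sucℤ (coordSum x)
coordSum-shift (a ∷ x) Fin.zero    = ℤP.+-assoc ℤ.1ℤ a (coordSum x)
coordSum-shift (a ∷ x) (Fin.suc i) = trans (cong (λ t → a ℤ.+ t) (coordSum-shift x i)) (swap a (coordSum x))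
  where
  swap : ∀ a s → a ℤ.+ (ℤ.1ℤ ℤ.+ s) ≡ ℤ.1ℤ ℤ.+ (a ℤ.+ s)
  swap = ℤS.solve-∀

shift-injective : (x : Pt d) (i j : Fin d) → shift x i ≡ shift x j → i ≡ j
shift-injective (a ∷ x) Fin.zero    Fin.zero    _ = refl
shift-injective (a ∷ x) Fin.zero    (Fin.suc j) e = ⊥-elim (ℤP.i≢suc[i] (sym (VecP.∷-injectiveˡ e)))
shift-injective (a ∷ x) (Fin.suc i) Fin.zero    e = ⊥-elim (ℤP.i≢suc[i] (VecP.∷-injectiveˡ e))
shift-injective (a ∷ x) (Fin.suc i) (Fin.suc j) e = cong Fin.suc (shift-injective x i j (VecP.∷-injectiveʳ e))

shift-shift≢ : (x : Pt d) (i j : Fin d) → shift (shift x j) i ≢ x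
shift-shift≢ x i j e = ℤP.<⇒≢ s<s+2 (sym (begin
  sucℤ (sucℤ (coordSum x))       ≡⟨ cong sucℤ (sym (coordSum-shift x j)) ⟩
  sucℤ (coordSum (shift x j))    ≡⟨ sym (coordSum-shift (shift x j) i) ⟩
  coordSum (shift (shift x j) i) ≡⟨ cong coordSum e ⟩
  coordSum x                     ∎))
  where
  open ≡-Reasoning
  s<s+2 : coordSum x ℤ.< sucℤ (sucℤ (coordSum x))
  s<s+2 = ℤP.suc[i]≤j⇒i<j (ℤP.i≤suc[i] _)

incL-unique : ∀ {e e′} {a b : Pt d} → IncL e a b → IncL e′ a b → e ≡ e′
incL-unique {e = x , i} {y , j} (inj₁ (refl , refl)) (inj₁ (refl , e)) = cong (x ,_) (shift-injective x i j e)
incL-unique {e = x , i} {y , j} (inj₁ (refl , refl)) (inj₂ (e , refl)) = ⊥-elim (shift-shift≢ _ _ _ (sym e))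
incL-unique {e = x , i} {y , j} (inj₂ (refl , refl)) (inj₁ (e , refl)) = ⊥-elim (shift-shift≢ _ _ _ e)
incL-unique {e = x , i} {y , j} (inj₂ (e , refl)) (inj₂ (e′ , refl)) =
  cong (x ,_) (shift-injective x i j (trans (sym e) e′))

-- Translations and automorphisms

infixl 6 _⊕_
_⊕_ : Pt d → Pt d → Pt d
_⊕_ = zipWith ℤ._+_

⊖_ : Pt d → Pt d
⊖_ = map (λ a → ℤ.- a)

⊕-identityʳ : (v : Pt d) → v ⊕ origin d ≡ v
⊕-identityʳ = VecP.zipWith-identityʳ ℤP.+-identityʳ

⊖-inverseˡ : (v : Pt d) → ⊖ v ⊕ v ≡ origin d
⊖-inverseˡ = VecP.zipWith-inverseˡ ℤP.+-inverseˡ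

⊖-cancelˡ : (v a : Pt d) → ⊖ v ⊕ (v ⊕ a) ≡ a
⊖-cancelˡ v a = begin
  ⊖ v ⊕ (v ⊕ a)   ≡⟨ VecP.zipWith-assoc ℤP.+-assoc (⊖ v) v a ⟨
  ⊖ v ⊕ v ⊕ a     ≡⟨ cong (_⊕ a) (⊖-inverseˡ v) ⟩
  origin _ ⊕ a    ≡⟨ VecP.zipWith-identityˡ ℤP.+-identityˡ a ⟩
  a               ∎
  where open ≡-Reasoning

⊕-cancelˡ : (v a : Pt d) → v ⊕ (⊖ v ⊕ a) ≡ a
⊕-cancelˡ v a = begin
  v ⊕ (⊖ v ⊕ a)   ≡⟨ VecP.zipWith-assoc ℤP.+-assoc v (⊖ v) a ⟨
  v ⊕ ⊖ v ⊕ a     ≡⟨ cong (_⊕ a) (VecP.zipWith-inverseʳ ℤP.+-inverseʳ v) ⟩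
  origin _ ⊕ a    ≡⟨ VecP.zipWith-identityˡ ℤP.+-identityˡ a ⟩
  a               ∎
  where open ≡-Reasoning

⊕-injective : (v : Pt d) {a b : Pt d} → v ⊕ a ≡ v ⊕ b → a ≡ b
⊕-injective v {a} {b} e = trans (sym (⊖-cancelˡ v a)) (trans (cong (⊖ v ⊕_) e) (⊖-cancelˡ v b))

shift-⊕ : (v a : Pt d) (i : Fin d) → shift (v ⊕ a) i ≡ v ⊕ shift a i
shift-⊕ (b ∷ v) (a ∷ x) Fin.zero    = cong (_∷ (v ⊕ x)) (shuffle b a)
  where
  shuffle : ∀ b a → ℤ.1ℤ ℤ.+ (b ℤ.+ a) ≡ b ℤ.+ (ℤ.1ℤ ℤ.+ a)
  shuffle = ℤS.solve-∀
shift-⊕ (b ∷ v) (a ∷ x) (Fin.suc i) = cong ((b ℤ.+ a) ∷_) (shift-⊕ v x i)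

dist-⊕ : (v x y : Pt d) → dist (v ⊕ x) (v ⊕ y) ≡ dist x y
dist-⊕ []      []      []      = refl
dist-⊕ (c ∷ v) (a ∷ x) (b ∷ y) = cong₂ _+_ (cong ∣_∣ (cancel c a b)) (dist-⊕ v x y)
  where
  cancel : ∀ c a b → (c ℤ.+ a) ℤ.- (c ℤ.+ b) ≡ a ℤ.- b
  cancel = ℤS.solve-∀

dist-⊕ʳ : (v a : Pt d) → dist v (v ⊕ a) ≡ dist (origin d) a
dist-⊕ʳ v a = trans (cong (λ t → dist t (v ⊕ a)) (sym (⊕-identityʳ v))) (dist-⊕ v (origin _) a)

dist-⊖ : (v y : Pt d) → dist (origin d) (⊖ v ⊕ y) ≡ dist v y
dist-⊖ v y = trans (sym (dist-⊕ʳ v (⊖ v ⊕ y))) (cong (dist v) (⊕-cancelˡ v y))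

incL-⊕ : (v : Pt d) {x a b : Pt d} {i : Fin d} → IncL (x , i) a b → IncL (v ⊕ x , i) (v ⊕ a) (v ⊕ b)
incL-⊕ v {x} {i = i} (inj₁ (refl , refl)) = inj₁ (refl , sym (shift-⊕ v x i))
incL-⊕ v {x} {i = i} (inj₂ (refl , refl)) = inj₂ (sym (shift-⊕ v x i) , refl)

incL-⊕⁻ : (v : Pt d) {x a b : Pt d} {i : Fin d} → IncL (v ⊕ x , i) (v ⊕ a) (v ⊕ b) → IncL (x , i) a b
incL-⊕⁻ v {x} {i = i} (inj₁ (va≡vx , vb≡svx)) =
  inj₁ (⊕-injective v va≡vx , ⊕-injective v (trans vb≡svx (shift-⊕ v x i)))
incL-⊕⁻ v {x} {i = i} (inj₂ (va≡svx , vb≡vx)) =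
  inj₂ (⊕-injective v (trans va≡svx (shift-⊕ v x i)) , ⊕-injective v vb≡vx)

aut-adj : (γ : Aut d) {e : Pt d × Fin d} {x y : Pt d} → IncL e x y → Adj (app γ x) (app γ y)
aut-adj γ {e} {x} {y} inc = Equivalence.to (Aut.preserves γ x y) (e , inc)

aut-walk : (γ : Aut d) {x y : Pt d} {n : ℕ} → x ⇝⟨ n ⟩ y → app γ x ⇝⟨ n ⟩ app γ y
aut-walk γ (stop refl)    = stop refl
aut-walk γ (step e inc p) with e′ , inc′ ← aut-adj γ inc = step e′ inc′ (aut-walk γ p)

-- Counting the points of a ball

missing-value⇒¬injective : ∀ {n} (g : Fin (suc n) → Fin (suc n)) (h : Fin (suc n)) →
                           (∀ x → g x ≢ h) → ¬ (∀ {x y} → g x ≡ g y → x ≡ y)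
missing-value⇒¬injective g h g≢h g-inj = ℕP.<-irrefl refl (FinP.injective⇒≤ squeezed-injective)
  where
  squeezed-injective : ∀ {x y} → Fin.punchOut (g≢h x ∘ sym) ≡ Fin.punchOut (g≢h y ∘ sym) → x ≡ y
  squeezed-injective = g-inj ∘ FinP.punchOut-injective (g≢h _ ∘ sym) (g≢h _ ∘ sym)

surjective⇒injective : ∀ {n} (f : Fin n → Fin n) → (∀ k → ∃[ j ] f j ≡ k) → ∀ {i j} → f i ≡ f j → i ≡ j
surjective⇒injective {suc n} f surj {i} {j} fi≡fj with i FinP.≟ j
... | yes i≡j = i≡j
... | no  i≢j = ⊥-elim (missing-value⇒¬injective g (proj₁ missed) (proj₂ missed) g-injective)
  where
  g : Fin (suc n) → Fin (suc n)
  g k = proj₁ (surj k)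

  g-injective : ∀ {a b} → g a ≡ g b → a ≡ b
  g-injective {a} {b} ga≡gb = trans (sym (proj₂ (surj a))) (trans (cong f ga≡gb) (proj₂ (surj b)))

  hit-by-image : ∀ {x k} → g x ≡ k → x ≡ f k
  hit-by-image {x} refl = sym (proj₂ (surj x))

  -- Only f i can hit i or j under g, and it hits at most one of them.
  missed : ∃[ h ] ∀ x → g x ≢ h
  missed with g (f i) FinP.≟ i
  ... | yes gfi≡i = j , λ x gx≡j →
    i≢j (trans (sym gfi≡i) (trans (cong g (sym (trans (hit-by-image gx≡j) (sym fi≡fj)))) gx≡j))
  ... | no  gfi≢i = i , λ x gx≡i → gfi≢i (trans (cong g (sym (hit-by-image gx≡i))) gx≡i)

module BallCounting (r : ℕ) where

  private
    M : ℕ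
    M = suc (r + r)

    encodeℤ : ℤ → Fin M
    encodeℤ z = ∣ z ℤ.+ + r ∣ mod M

    decodeℤ : Fin M → ℤ
    decodeℤ i = + Fin.toℕ i ℤ.- + r

    toℕ-mod : ∀ n → n < M → Fin.toℕ (n mod M) ≡ n
    toℕ-mod n n<M = trans (FinP.toℕ-fromℕ< _) (m<n⇒m%n≡m n<M)

    encodeℤ∘decodeℤ : ∀ i → encodeℤ (decodeℤ i) ≡ i
    encodeℤ∘decodeℤ i = FinP.toℕ-injective (trans
      (cong (λ t → Fin.toℕ (∣ t ∣ mod M)) (cancel (+ Fin.toℕ i) (+ r)))
      (toℕ-mod (Fin.toℕ i) (FinP.toℕ<n i)))
      where
      cancel : ∀ t r → (t ℤ.- r) ℤ.+ r ≡ t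
      cancel = ℤS.solve-∀

    shifted-into-range : ∀ z → ∣ z ∣ ≤ r → ∃[ n ] z ℤ.+ + r ≡ + n × n < M
    shifted-into-range (+ m)    ∣z∣≤r = m + r , refl , s≤s (ℕP.+-monoˡ-≤ r ∣z∣≤r)
    shifted-into-range -[1+ m ] ∣z∣≤r =
      r ∸ suc m , ℤP.⊖-≥ ∣z∣≤r , s≤s (ℕP.≤-trans (ℕP.m∸n≤m r (suc m)) (ℕP.m≤m+n r r))

    decodeℤ∘encodeℤ : ∀ z → ∣ z ∣ ≤ r → decodeℤ (encodeℤ z) ≡ z
    decodeℤ∘encodeℤ z ∣z∣≤r with n , z+r≡n , n<M ← shifted-into-range z ∣z∣≤r = begin
      + Fin.toℕ (∣ z ℤ.+ + r ∣ mod M) ℤ.- + r ≡⟨ cong (λ t → + Fin.toℕ (∣ t ∣ mod M) ℤ.- + r) z+r≡n ⟩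
      + Fin.toℕ (n mod M) ℤ.- + r             ≡⟨ cong (λ t → + t ℤ.- + r) (toℕ-mod n n<M) ⟩
      + n ℤ.- + r                             ≡⟨ cong (ℤ._- + r) z+r≡n ⟨
      z ℤ.+ + r ℤ.- + r                       ≡⟨ cancel z (+ r) ⟩
      z                                       ∎
      where
      open ≡-Reasoning
      cancel : ∀ z r → z ℤ.+ r ℤ.- r ≡ z
      cancel = ℤS.solve-∀

    coordinate-bound : (a : Pt d) → dist (origin d) a ≤ r → ∀ j → ∣ lookup a j ∣ ≤ r
    coordinate-bound (b ∷ a) a∈B Fin.zero =
      ℕP.≤-trans (ℕP.≤-reflexive (trans (sym (ℤP.∣-i∣≡∣i∣ b)) (cong ∣_∣ (sym (ℤP.+-identityˡ (ℤ.- b))))))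
                 (ℕP.≤-trans (ℕP.m≤m+n _ _) a∈B)
    coordinate-bound (b ∷ a) a∈B (Fin.suc j) = coordinate-bound a (ℕP.≤-trans (ℕP.m≤n+m _ _) a∈B) j

    funToFin-cong : ∀ {m} {f g : Fin m → Fin M} → (∀ j → f j ≡ g j) → Fin.funToFin f ≡ Fin.funToFin g
    funToFin-cong {zero}  f≗g = refl
    funToFin-cong {suc m} f≗g = cong₂ Fin.combine (f≗g Fin.zero) (funToFin-cong (f≗g ∘ Fin.suc))

    encode : Pt d → Fin (M ^ d)
    encode a = Fin.funToFin (λ j → encodeℤ (lookup a j))

    decode : Fin (M ^ d) → Pt d
    decode k = tabulate (λ j → decodeℤ (Fin.finToFun k j))

    decode∘encode : (a : Pt d) → dist (origin d) a ≤ r → decode (encode a) ≡ a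
    decode∘encode a a∈B = trans
      (VecP.tabulate-cong (λ j → trans (cong decodeℤ (FinP.finToFun-funToFin _ j))
                                       (decodeℤ∘encodeℤ _ (coordinate-bound a a∈B j))))
      (VecP.tabulate∘lookup a)

    encode∘decode : (k : Fin (M ^ d)) → encode {d} (decode k) ≡ k
    encode∘decode {d} k = trans
      (funToFin-cong {d} (λ j → trans (cong encodeℤ (VecP.lookup∘tabulate _ j)) (encodeℤ∘decodeℤ _)))
      (FinP.funToFin-finToFin {d} k)

  Ball : ℕ → Set
  Ball d = Σ (Pt d) λ t → dist (origin d) t ≤ r

  ball-≡ : {t u : Ball d} → proj₁ t ≡ proj₁ u → t ≡ u
  ball-≡ {t = a , p} {u = .a , q} refl = cong (a ,_) (ℕP.≤-irrelevant p q)

  -- Encoding the cube [-r, r]^d as Fin (M ^ d) and extending by the identity off the ball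
  -- turns ψ into a surjective self-map of a finite set.
  ball-surjective⇒injective : (ψ : Ball d → Pt d) → ((b : Ball d) → Σ (Ball d) λ t → ψ t ≡ proj₁ b) →
                              ∀ t u → ψ t ≡ ψ u → proj₁ t ≡ proj₁ u
  ball-surjective⇒injective {d} ψ ψ-surj t u ψt≡ψu = begin
    proj₁ t                  ≡⟨ decode∘encode _ (proj₂ t) ⟨
    decode (encode (proj₁ t)) ≡⟨ cong decode (surjective⇒injective g g-surjective gt≡gu) ⟩
    decode (encode (proj₁ u)) ≡⟨ decode∘encode _ (proj₂ u) ⟩
    proj₁ u                  ∎
    where
    open ≡-Reasoning

    g : Fin (M ^ d) → Fin (M ^ d)
    g k with dist (origin d) (decode k) ≤? r
    ... | yes k∈B = encode (ψ (decode k , k∈B))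
    ... | no  _   = k

    g∘encode : ∀ t → g (encode (proj₁ t)) ≡ encode (ψ t)
    g∘encode (a , a∈B) with dist (origin d) (decode (encode a)) ≤? r
    ... | yes k∈B = cong (encode ∘ ψ) (ball-≡ (decode∘encode a a∈B))
    ... | no  k∉B = ⊥-elim (k∉B (subst (λ t → dist (origin d) t ≤ r) (sym (decode∘encode a a∈B)) a∈B))

    g-off-ball : ∀ k → ¬ dist (origin d) (decode k) ≤ r → g k ≡ k
    g-off-ball k k∉B with dist (origin d) (decode k) ≤? r
    ... | yes k∈B = ⊥-elim (k∉B k∈B)
    ... | no  _   = refl

    gt≡gu : g (encode (proj₁ t)) ≡ g (encode (proj₁ u))
    gt≡gu = trans (g∘encode t) (trans (cong encode ψt≡ψu) (sym (g∘encode u)))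

    g-surjective : ∀ k → ∃[ j ] g j ≡ k
    g-surjective k with dist (origin d) (decode k) ≤? r
    ... | no  k∉B = k , g-off-ball k k∉B
    ... | yes k∈B with t , ψt≡k ← ψ-surj (decode {d} k , k∈B) =
      encode (proj₁ t) , trans (g∘encode t) (trans (cong encode ψt≡k) (encode∘decode {d} k))

-- Orbits, the quotient graph, and separation

module Quotient {d : ℕ} {Γ : Aut d → Set} (S : IsSubgroup Γ) where
  open IsSubgroup S

  infix 4 _∼_
  _∼_ : Pt d → Pt d → Set
  _∼_ = OrbV Γ

  ∼-refl : ∀ {x} → x ∼ x
  ∼-refl {x} with ι , ι∈Γ , ι-id ← has-id = ι , ι∈Γ , ι-id x

  ∼-reflexive : ∀ {x y} → x ≡ y → x ∼ y
  ∼-reflexive refl = ∼-refl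

  inverse : ∀ {γ} → Γ γ → Σ (Aut d) λ β → Γ β × (∀ {a b} → app γ a ≡ b → app β b ≡ a)
  inverse γ∈Γ with β , β∈Γ , βγ≡id ← has-inv _ γ∈Γ = β , β∈Γ , λ { {a} refl → βγ≡id a }

  ∼-sym : ∀ {x y} → x ∼ y → y ∼ x
  ∼-sym (γ , γ∈Γ , γx≡y) with β , β∈Γ , undo ← inverse γ∈Γ = β , β∈Γ , undo γx≡y

  ∼-trans : ∀ {x y z} → x ∼ y → y ∼ z → x ∼ z
  ∼-trans (α , α∈Γ , refl) (β , β∈Γ , refl) with γ , γ∈Γ , γ≡βα ← has-∘ β α β∈Γ α∈Γ = γ , γ∈Γ , γ≡βα _

  orbitE-refl : ∀ {e} → OrbE Γ e e
  orbitE-refl {x , i} with ι , ι∈Γ , ι-id ← has-id = ι , ι∈Γ , inj₁ (ι-id x , ι-id (shift x i))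

  orbitE-sym : ∀ {e e′} → OrbE Γ e e′ → OrbE Γ e′ e
  orbitE-sym (γ , γ∈Γ , inj₁ (γx≡y , γsx≡sy)) with β , β∈Γ , undo ← inverse γ∈Γ =
    β , β∈Γ , inj₁ (undo γx≡y , undo γsx≡sy)
  orbitE-sym (γ , γ∈Γ , inj₂ (γx≡sy , γsx≡y)) with β , β∈Γ , undo ← inverse γ∈Γ =
    β , β∈Γ , inj₂ (undo γsx≡y , undo γx≡sy)

  incL⇒orbitE : ∀ {γ w j z i} → Γ γ → IncL (w , j) (app γ z) (app γ (shift z i)) → OrbE Γ (w , j) (z , i)
  incL⇒orbitE γ∈Γ inc with β , β∈Γ , undo ← inverse γ∈Γ | inc
  ... | inj₁ (γz≡w , γsz≡sw) = β , β∈Γ , inj₁ (undo γz≡w , undo γsz≡sw)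
  ... | inj₂ (γz≡sw , γsz≡w) = β , β∈Γ , inj₂ (undo γsz≡w , undo γz≡sw)

  incQ-resp-∼ : ∀ {e a b a′ b′} → IncQ Γ e a b → a ∼ a′ → b ∼ b′ → IncQ Γ e a′ b′
  incQ-resp-∼ (inj₁ (o₁ , o₂)) a∼a′ b∼b′ = inj₁ (∼-trans o₁ a∼a′ , ∼-trans o₂ b∼b′)
  incQ-resp-∼ (inj₂ (o₁ , o₂)) a∼a′ b∼b′ = inj₂ (∼-trans o₁ a∼a′ , ∼-trans o₂ b∼b′)

  incQ-resp-orbitE : ∀ {e e′ a b} → OrbE Γ e e′ → IncQ Γ e a b → IncQ Γ e′ a b
  incQ-resp-orbitE (γ , γ∈Γ , inj₁ (e₁ , e₂)) (inj₁ (o₁ , o₂)) =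
    inj₁ (∼-trans (∼-sym (γ , γ∈Γ , e₁)) o₁ , ∼-trans (∼-sym (γ , γ∈Γ , e₂)) o₂)
  incQ-resp-orbitE (γ , γ∈Γ , inj₁ (e₁ , e₂)) (inj₂ (o₁ , o₂)) =
    inj₂ (∼-trans (∼-sym (γ , γ∈Γ , e₂)) o₁ , ∼-trans (∼-sym (γ , γ∈Γ , e₁)) o₂)
  incQ-resp-orbitE (γ , γ∈Γ , inj₂ (e₁ , e₂)) (inj₁ (o₁ , o₂)) =
    inj₂ (∼-trans (∼-sym (γ , γ∈Γ , e₁)) o₁ , ∼-trans (∼-sym (γ , γ∈Γ , e₂)) o₂)
  incQ-resp-orbitE (γ , γ∈Γ , inj₂ (e₁ , e₂)) (inj₂ (o₁ , o₂)) =
    inj₁ (∼-trans (∼-sym (γ , γ∈Γ , e₂)) o₁ , ∼-trans (∼-sym (γ , γ∈Γ , e₁)) o₂)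

  incL⇒incQ : ∀ {e a b} → IncL e a b → IncQ Γ e a b
  incL⇒incQ (inj₁ (refl , refl)) = inj₁ (∼-refl , ∼-refl)
  incL⇒incQ (inj₂ (refl , refl)) = inj₂ (∼-refl , ∼-refl)

  QWalk : Pt d → Pt d → ℕ → Set
  QWalk = Walkᴵ (Quot Γ)

  qwalk-start : ∀ {u u′ v n} → u ∼ u′ → QWalk u v n → QWalk u′ v n
  qwalk-start u∼u′ (stop u∼v)     = stop (∼-trans (∼-sym u∼u′) u∼v)
  qwalk-start u∼u′ (step e inc p) = step e (incQ-resp-∼ inc u∼u′ ∼-refl) p

  qwalk-end : ∀ {u v v′ n} → QWalk u v n → v ∼ v′ → QWalk u v′ n
  qwalk-end (stop u∼v)     v∼v′ = stop (∼-trans u∼v v∼v′)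
  qwalk-end (step e inc p) v∼v′ = step e inc (qwalk-end p v∼v′)

  project : ∀ {x y n} → x ⇝⟨ n ⟩ y → QWalk x y n
  project (stop refl)    = stop ∼-refl
  project (step e inc p) = step e (incL⇒incQ inc) (project p)

  orbit-walk : ∀ {x x′ y n} → x ∼ x′ → x ⇝⟨ n ⟩ y → ∃[ y′ ] y ∼ y′ × x′ ⇝⟨ n ⟩ y′
  orbit-walk (γ , γ∈Γ , refl) p = app γ _ , (γ , γ∈Γ , refl) , aut-walk γ p

  walk-via-orbits : ∀ {e s t u w y y′ n} → IncL e s t → s ∼ u → t ∼ w →
                    y ∼ y′ → w ⇝⟨ n ⟩ y′ → ∃[ y″ ] y ∼ y″ × u ⇝⟨ suc n ⟩ y″
  walk-via-orbits {e} inc s∼u t∼w y∼y′ p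
    with y″ , y′∼y″ , t⇝y″ ← orbit-walk (∼-sym t∼w) p
    with y‴ , y″∼y‴ , u⇝y‴ ← orbit-walk s∼u (step e inc t⇝y″)
    = y‴ , ∼-trans y∼y′ (∼-trans y′∼y″ y″∼y‴) , u⇝y‴

  lift : ∀ {x y n} → QWalk x y n → ∃[ y′ ] y ∼ y′ × x ⇝⟨ n ⟩ y′
  lift (stop x∼y) = _ , ∼-sym x∼y , stop refl
  lift (step e inc q) with y′ , y∼y′ , w⇝y′ ← lift q | inc
  ... | inj₁ (p∼u , sp∼w) = walk-via-orbits (inj₁ (refl , refl)) p∼u sp∼w y∼y′ w⇝y′
  ... | inj₂ (sp∼u , p∼w) = walk-via-orbits (inj₂ (refl , refl)) sp∼u p∼w y∼y′ w⇝y′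

  Separated : ℕ → Set
  Separated k = ∀ {x y n} → x ∼ y → x ⇝⟨ n ⟩ y → n < k → x ≡ y

  dispGe⇒separated : ∀ {k} → DispGe Γ k → Separated k
  dispGe⇒separated disp {x} (γ , γ∈Γ , refl) p n<k with VecP.≡-dec ℤ._≟_ (app γ x) x
  ... | yes γx≡x = sym γx≡x
  ... | no  γx≢x = ⊥-elim (ℕP.<⇒≱ n<k (disp γ γ∈Γ (λ γ-id → γx≢x (γ-id x)) x _ (fromWalkᴵ p)))

  module _ {k} (2<k : 2 < k) (sep : Separated k) {γ} (γ∈Γ : Γ γ) where

    fixed-neighbour : ∀ {e w u} → app γ w ≡ w → IncL e w u → app γ u ≡ u
    fixed-neighbour {e} {w} {u} γw≡w inc with e′ , inc′ ← aut-adj γ inc =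
      sym (sep (γ , γ∈Γ , refl) (step e (incL-sym inc) (step e′ w—γu (stop refl))) 2<k)
      where
      w—γu : IncL e′ w (app γ u)
      w—γu = subst (λ t → IncL e′ t (app γ u)) γw≡w inc′

    fixed-along : ∀ {w y n} → app γ w ≡ w → w ⇝⟨ n ⟩ y → app γ y ≡ y
    fixed-along γw≡w (stop refl)    = γw≡w
    fixed-along γw≡w (step e inc p) = fixed-along (fixed-neighbour γw≡w inc) p

  separated⇒dispGe : ∀ {k} → 2 < k → Separated k → DispGe Γ k
  separated⇒dispGe {k} 2<k sep γ γ∈Γ γ≢id x n p with k ≤? n
  ... | yes k≤n = k≤n
  ... | no  k≰n = ⊥-elim (γ≢id λ y → fixed-along 2<k sep γ∈Γ γx≡x (geodesic x y))
    where
    γx≡x : app γ x ≡ x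
    γx≡x = sym (sep (γ , γ∈Γ , refl) (toWalkᴵ n p) (ℕP.≰⇒> k≰n))

  module QuotientBalls (v : Pt d) (r : ℕ) where

    dist≤⇒distLeQ : ∀ {y} → dist v y ≤ r → DistLe (Quot Γ) v y r
    dist≤⇒distLeQ {y} d≤r = dist v y , d≤r , fromWalkᴵ (project (geodesic v y))

    distLeQ-resp-∼ : ∀ {y y′} → DistLe (Quot Γ) v y r → y ∼ y′ → DistLe (Quot Γ) v y′ r
    distLeQ-resp-∼ (n , n≤r , p) y∼y′ = n , n≤r , fromWalkᴵ (qwalk-end (toWalkᴵ n p) y∼y′)

    distLeQ⇒lift : ∀ {y} → DistLe (Quot Γ) v y r → ∃[ y′ ] y ∼ y′ × dist v y′ ≤ r
    distLeQ⇒lift (n , n≤r , p) with y′ , y∼y′ , q ← lift (toWalkᴵ n p) =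
      y′ , y∼y′ , ℕP.≤-trans (dist≤length q) n≤r

    distGeQ⇒≤dist : ∀ {y} → DistGe (Quot Γ) v y r → r ≤ dist v y
    distGeQ⇒≤dist {y} ge = ge _ (fromWalkᴵ (project (geodesic v y)))

    ≤orbit-dist⇒distGeQ : ∀ {y} → (∀ {y′} → y ∼ y′ → r ≤ dist v y′) → DistGe (Quot Γ) v y r
    ≤orbit-dist⇒distGeQ r≤ n p with y′ , y∼y′ , q ← lift (toWalkᴵ n p) = ℕP.≤-trans (r≤ y∼y′) (dist≤length q)

    distEqQ-resp-∼ : ∀ {y y′} → DistEq (Quot Γ) v y r → y ∼ y′ → DistEq (Quot Γ) v y′ r
    distEqQ-resp-∼ (le , ge) y∼y′ =
      distLeQ-resp-∼ le y∼y′ , λ n p → ge n (fromWalkᴵ (qwalk-end (toWalkᴵ n p) (∼-sym y∼y′)))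

    ends⇒edgeInBallQ : ∀ {x i} → DistLe (Quot Γ) v x r → DistLe (Quot Γ) v (shift x i) r →
                       EdgeInBall (Quot Γ) v r (x , i)
    ends⇒edgeInBallQ x∈B sx∈B _ _ (inj₁ (x∼a , sx∼b)) = distLeQ-resp-∼ x∈B x∼a , distLeQ-resp-∼ sx∈B sx∼b
    ends⇒edgeInBallQ x∈B sx∈B _ _ (inj₂ (sx∼a , x∼b)) = distLeQ-resp-∼ sx∈B sx∼a , distLeQ-resp-∼ x∈B x∼b

    incL⇒edgeInBallQ : ∀ {e a b} → IncL e a b → DistLe (Quot Γ) v a r → DistLe (Quot Γ) v b r →
                       EdgeInBall (Quot Γ) v r e
    incL⇒edgeInBallQ {e = _ , _} inc a∈B b∈B =
      uncurry ends⇒edgeInBallQ (incL-ends (λ y → DistLe (Quot Γ) v y r) inc a∈B b∈B)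

    onSphereQ⇒ends : ∀ {z i} → EdgeOnSphere (Quot Γ) v r (z , i) →
                     DistGe (Quot Γ) v z r × DistGe (Quot Γ) v (shift z i) r
    onSphereQ⇒ends (a , b , inj₁ (z∼a , sz∼b) , a-sph , b-sph) =
      proj₂ (distEqQ-resp-∼ a-sph (∼-sym z∼a)) , proj₂ (distEqQ-resp-∼ b-sph (∼-sym sz∼b))
    onSphereQ⇒ends (a , b , inj₂ (sz∼a , z∼b) , a-sph , b-sph) =
      proj₂ (distEqQ-resp-∼ b-sph (∼-sym z∼b)) , proj₂ (distEqQ-resp-∼ a-sph (∼-sym sz∼a))

  module LinksFromSeparation (r : ℕ) {k : ℕ} (2r+1≤k : 2 * r + 1 ≤ k) (sep : Separated k) (v : Pt d) where

    open QuotientBalls v r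

    private
      o : Pt d
      o = origin d

      B₀ : Pt d → Set
      B₀ a = DistLe (𝕃 d) o a r

      Bᵥ : Pt d → Set
      Bᵥ y = dist v y ≤ r

    ball-separated : ∀ {y y′} → Bᵥ y → Bᵥ y′ → y ∼ y′ → y ≡ y′
    ball-separated {y} {y′} y∈B y′∈B y∼y′ =
      sep y∼y′ (reverse (geodesic v y) ++ᵂ geodesic v y′)
          (ℕP.<-≤-trans (m≤n⇒m<n+1 (m≤o⇒n≤o⇒m+n≤2*o y∈B y′∈B)) 2r+1≤k)

    ball-dist-minimal : ∀ {y y′} → Bᵥ y → y ∼ y′ → dist v y ≤ dist v y′
    ball-dist-minimal {y} {y′} y∈B y∼y′ with dist v y′ ≤? r
    ... | yes y′∈B = ℕP.≤-reflexive (cong (dist v) (ball-separated y∈B y′∈B y∼y′))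
    ... | no  y′∉B = ℕP.≤-trans y∈B (ℕP.<⇒≤ (ℕP.≰⇒> y′∉B))

    sphere-criterion : ∀ {y} → Bᵥ y → r ≤ dist v y → DistEq (Quot Γ) v y r
    sphere-criterion y∈B r≤d =
      dist≤⇒distLeQ y∈B , ≤orbit-dist⇒distGeQ λ y∼y′ → ℕP.≤-trans r≤d (ball-dist-minimal y∈B y∼y′)

    ball-⊕ : ∀ {a} → B₀ a → Bᵥ (v ⊕ a)
    ball-⊕ {a} a∈B = subst (_≤ r) (sym (dist-⊕ʳ v a)) (Equivalence.to distLe⇔dist≤ a∈B)

    ball-⊖ : ∀ {y} → Bᵥ y → B₀ (⊖ v ⊕ y)
    ball-⊖ {y} y∈B = Equivalence.from distLe⇔dist≤ (subst (_≤ r) (sym (dist-⊖ v y)) y∈B)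

    vertex : V (Link (𝕃 d) o r) → V (Link (Quot Γ) v r)
    vertex (a , a∈B) = v ⊕ a , dist≤⇒distLeQ (ball-⊕ a∈B)

    vertex-injective : ∀ {a b} → B₀ a → B₀ b → v ⊕ a ∼ v ⊕ b → a ≡ b
    vertex-injective a∈B b∈B va∼vb = ⊕-injective v (ball-separated (ball-⊕ a∈B) (ball-⊕ b∈B) va∼vb)

    vertex-surjective : (c : V (Link (Quot Γ) v r)) → Σ (V (Link (𝕃 d) o r)) λ a → v ⊕ proj₁ a ∼ proj₁ c
    vertex-surjective (y , y∈Q) with y′ , y∼y′ , y′∈B ← distLeQ⇒lift y∈Q =
      (⊖ v ⊕ y′ , ball-⊖ y′∈B) , subst (_∼ y) (sym (⊕-cancelˡ v y′)) (∼-sym y∼y′)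

    vertex-pointed : (c : V (Link (𝕃 d) o r)) → proj₁ c ≡ o → v ⊕ proj₁ c ∼ v
    vertex-pointed c c≡o = ∼-reflexive (trans (cong (v ⊕_) c≡o) (⊕-identityʳ v))

    edge-ends : ∀ {x i} → EdgeInBall (𝕃 d) o r (x , i) → Bᵥ (v ⊕ x) × Bᵥ (shift (v ⊕ x) i)
    edge-ends {x} {i} e∈B with x∈B , sx∈B ← Equivalence.to edgeInBall𝕃⇔ e∈B =
      ball-⊕ x∈B , subst Bᵥ (sym (shift-⊕ v x i)) (ball-⊕ sx∈B)

    edge : E (Link (𝕃 d) o r) → E (Link (Quot Γ) v r)
    edge ((x , i) , e∈B) =
      (v ⊕ x , i) , ends⇒edgeInBallQ (dist≤⇒distLeQ (proj₁ (edge-ends e∈B)))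
                                     (dist≤⇒distLeQ (proj₂ (edge-ends e∈B)))

    ball-edge-separated : ∀ {x i y j} → Bᵥ x → Bᵥ (shift x i) → Bᵥ y → Bᵥ (shift y j) →
                          OrbE Γ (x , i) (y , j) → (x , i) ≡ (y , j)
    ball-edge-separated x∈B sx∈B y∈B sy∈B (γ , γ∈Γ , inj₁ (γx≡y , γsx≡sy)) = incL-unique (inj₁ (refl , refl))
      (inj₁ (ball-separated x∈B y∈B (γ , γ∈Γ , γx≡y) , ball-separated sx∈B sy∈B (γ , γ∈Γ , γsx≡sy)))
    ball-edge-separated x∈B sx∈B y∈B sy∈B (γ , γ∈Γ , inj₂ (γx≡sy , γsx≡y)) = incL-unique (inj₁ (refl , refl))
      (inj₂ (ball-separated x∈B sy∈B (γ , γ∈Γ , γx≡sy) , ball-separated sx∈B y∈B (γ , γ∈Γ , γsx≡y)))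

    edge-injective : ∀ {x i y j} → EdgeInBall (𝕃 d) o r (x , i) → EdgeInBall (𝕃 d) o r (y , j) →
                     OrbE Γ (v ⊕ x , i) (v ⊕ y , j) → (x , i) ≡ (y , j)
    edge-injective e∈B f∈B oe with ball-edge-separated (proj₁ (edge-ends e∈B)) (proj₂ (edge-ends e∈B))
                                                       (proj₁ (edge-ends f∈B)) (proj₂ (edge-ends f∈B)) oe
    ... | vx,i≡vy,j = cong₂ _,_ (⊕-injective v (cong proj₁ vx,i≡vy,j)) (cong proj₂ vx,i≡vy,j)

    edge-incidence : ∀ {x i a b} → IncL (x , i) a b → IncQ Γ (v ⊕ x , i) (v ⊕ a) (v ⊕ b)
    edge-incidence inc = incL⇒incQ (incL-⊕ v inc)

    ball-incidence : ∀ {y j a b} → Bᵥ y → Bᵥ (shift y j) → Bᵥ a → Bᵥ b →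
                     IncQ Γ (y , j) a b → IncL (y , j) a b
    ball-incidence y∈B sy∈B a∈B b∈B (inj₁ (y∼a , sy∼b)) =
      inj₁ (sym (ball-separated y∈B a∈B y∼a) , sym (ball-separated sy∈B b∈B sy∼b))
    ball-incidence y∈B sy∈B a∈B b∈B (inj₂ (sy∼a , y∼b)) =
      inj₂ (sym (ball-separated sy∈B a∈B sy∼a) , sym (ball-separated y∈B b∈B y∼b))

    edge-incidence⁻ : ∀ {x i a b} → B₀ a → B₀ b → EdgeInBall (𝕃 d) o r (x , i) →
                      IncQ Γ (v ⊕ x , i) (v ⊕ a) (v ⊕ b) → IncL (x , i) a b
    edge-incidence⁻ a∈B b∈B e∈B inc =
      incL-⊕⁻ v (ball-incidence (proj₁ (edge-ends e∈B)) (proj₂ (edge-ends e∈B)) (ball-⊕ a∈B) (ball-⊕ b∈B) inc)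

    EdgePreimage : Pt d × Fin d → Set
    EdgePreimage g = Σ (Pt d × Fin d) λ e → EdgeInBall (𝕃 d) o r e × OrbE Γ (v ⊕ proj₁ e , proj₂ e) g

    edge-preimage : ∀ {γ z i} → Γ γ → Bᵥ (app γ z) → Bᵥ (app γ (shift z i)) → EdgePreimage (z , i)
    edge-preimage {γ} γ∈Γ γz∈B γsz∈B with (w , j) , inc ← aut-adj γ (inj₁ (refl , refl)) =
      (⊖ v ⊕ w , j) ,
      Equivalence.from edgeInBall𝕃⇔ (ball-⊖ w∈B , subst B₀ (sym (shift-⊕ (⊖ v) w j)) (ball-⊖ sw∈B)) ,
      subst (λ t → OrbE Γ (t , j) _) (sym (⊕-cancelˡ v w)) (incL⇒orbitE γ∈Γ inc)
      where
      w∈B×sw∈B : dist v w ≤ r × dist v (shift w j) ≤ r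
      w∈B×sw∈B = incL-ends Bᵥ inc γz∈B γsz∈B
      w∈B = proj₁ w∈B×sw∈B
      sw∈B = proj₂ w∈B×sw∈B

    -- With k ≥ 2r+2, lifting one end of a quotient edge into the ball drags the other end along.
    edge-surjective : 2 * r + 2 ≤ k → ∀ {z i} → EdgeInBall (Quot Γ) v r (z , i) → EdgePreimage (z , i)
    edge-surjective 2r+2≤k {z} {i} e∈Q
      with z∈Q , sz∈Q ← e∈Q z (shift z i) (inj₁ (∼-refl , ∼-refl))
      with _ , (γ , γ∈Γ , refl) , γz∈B ← distLeQ⇒lift z∈Q
         | y , sz∼y , y∈B ← distLeQ⇒lift sz∈Q
      with (e , inc) ← aut-adj γ {e = z , i} (inj₁ (refl , refl))
      = edge-preimage γ∈Γ γz∈B (subst Bᵥ (sym γsz≡y) y∈B)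
      where
      γsz≡y : app γ (shift z i) ≡ y
      γsz≡y = sep (∼-trans (∼-sym (γ , γ∈Γ , refl)) sz∼y)
                  (step e (incL-sym inc) (reverse (geodesic v (app γ z)) ++ᵂ geodesic v y))
                  (ℕP.≤-trans (s≤s (s≤s (m≤o⇒n≤o⇒m+n≤2*o γz∈B y∈B)))
                              (subst (_≤ k) (ℕP.+-comm (2 * r) 2) 2r+2≤k))

    near-sphere : ∀ {γ e y y′} → Γ γ → IncL e y y′ → Bᵥ (app γ y) → r < dist v (app γ y′) →
                  DistEq (Quot Γ) v y r
    near-sphere {γ} {y = y} γ∈Γ inc γy∈B γy′∉B =
      distEqQ-resp-∼ (sphere-criterion γy∈B r≤γy) (∼-sym (γ , γ∈Γ , refl))
      where
      r≤γy : r ≤ dist v (app γ y)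
      r≤γy = ℕP.≤-pred (ℕP.≤-trans γy′∉B (adjacent-dist v (proj₂ (aut-adj γ inc))))

    edge-surjective⁻ : ∀ {z i} → EdgeInBall (Quot Γ) v r (z , i) → ¬ EdgeOnSphere (Quot Γ) v r (z , i) →
                       EdgePreimage (z , i)
    edge-surjective⁻ {z} {i} e∈Q e∉S
      with z∈Q , sz∈Q ← e∈Q z (shift z i) (inj₁ (∼-refl , ∼-refl))
      with _ , (γ , γ∈Γ , refl) , γz∈B ← distLeQ⇒lift z∈Q
         | _ , (γ′ , γ′∈Γ , refl) , γ′sz∈B ← distLeQ⇒lift sz∈Q
      with dist v (app γ (shift z i)) ≤? r | dist v (app γ′ z) ≤? r
    ... | yes γsz∈B | _        = edge-preimage γ∈Γ γz∈B γsz∈B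
    ... | no _      | yes γ′z∈B = edge-preimage γ′∈Γ γ′z∈B γ′sz∈B
    ... | no γsz∉B  | no γ′z∉B = ⊥-elim (e∉S (z , shift z i , inj₁ (∼-refl , ∼-refl) ,
          near-sphere γ∈Γ (inj₁ (refl , refl)) γz∈B (ℕP.≰⇒> γsz∉B) ,
          near-sphere γ′∈Γ (inj₂ (refl , refl)) γ′sz∈B (ℕP.≰⇒> γ′z∉B)))

    far-⊕ : ∀ {a} → DistGe (Quot Γ) v (v ⊕ a) r → DistGe (𝕃 d) o a r
    far-⊕ {a} a-far = Equivalence.from distGe⇔≤dist (subst (r ≤_) (dist-⊕ʳ v a) (distGeQ⇒≤dist a-far))

    sphere-⊕ : ∀ {a} → DistEq (𝕃 d) o a r → DistEq (Quot Γ) v (v ⊕ a) r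
    sphere-⊕ {a} (a∈B , a-far) =
      sphere-criterion (ball-⊕ a∈B) (subst (r ≤_) (sym (dist-⊕ʳ v a)) (Equivalence.to distGe⇔≤dist a-far))

    edge-off-sphere : ∀ {x i} → EdgeInBall (𝕃 d) o r (x , i) → ¬ EdgeOnSphere (𝕃 d) o r (x , i) →
                      ¬ EdgeOnSphere (Quot Γ) v r (v ⊕ x , i)
    edge-off-sphere {x} {i} e∈B e∉S e∈S with x∈B , sx∈B ← Equivalence.to edgeInBall𝕃⇔ e∈B
                                           | x-far , sx-far ← onSphereQ⇒ends e∈S =
      e∉S (x , shift x i , inj₁ (refl , refl) , (x∈B , far-⊕ x-far) ,
           (sx∈B , far-⊕ (subst (λ t → DistGe (Quot Γ) v t r) (shift-⊕ v x i) sx-far)))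

    preimage-off-sphere : ∀ {x j z i} → OrbE Γ (v ⊕ x , j) (z , i) → ¬ EdgeOnSphere (Quot Γ) v r (z , i) →
                          ¬ EdgeOnSphere (𝕃 d) o r (x , j)
    preimage-off-sphere oe e∉S (a , b , inc , a-sph , b-sph) =
      e∉S (v ⊕ a , v ⊕ b , incQ-resp-orbitE oe (edge-incidence inc) , sphere-⊕ a-sph , sphere-⊕ b-sph)

    link-iso : 2 * r + 2 ≤ k → PointedLinkIso (𝕃 d) (Quot Γ) o v r
    link-iso 2r+2≤k = record
      { fV      = vertex
      ; fV-cong = λ a≡b → ∼-reflexive (cong (v ⊕_) a≡b)
      ; fV-inj  = λ {a} {b} → vertex-injective (proj₂ a) (proj₂ b)
      ; fV-surj = vertex-surjective
      ; fE      = edge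
      ; fE-cong = λ { refl → orbitE-refl }
      ; fE-inj  = λ {e} {f} → edge-injective (proj₂ e) (proj₂ f)
      ; fE-surj = λ (g , g∈Q) → let (e , e∈B , oe) = edge-surjective 2r+2≤k g∈Q in (e , e∈B) , oe
      ; inc     = λ _ _ _ → edge-incidence
      ; inc⁻    = λ e a b → edge-incidence⁻ (proj₂ a) (proj₂ b) (proj₂ e)
      } , vertex-pointed

    link⁻-iso : PointedLink⁻Iso (𝕃 d) (Quot Γ) o v r
    link⁻-iso = record
      { fV      = vertex
      ; fV-cong = λ a≡b → ∼-reflexive (cong (v ⊕_) a≡b)
      ; fV-inj  = λ {a} {b} → vertex-injective (proj₂ a) (proj₂ b)
      ; fV-surj = vertex-surjective
      ; fE      = λ (e , e∈B , e∉S) → let (e′ , e′∈B) = edge (e , e∈B) in e′ , e′∈B , edge-off-sphere e∈B e∉S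
      ; fE-cong = λ { refl → orbitE-refl }
      ; fE-inj  = λ {e} {f} → edge-injective (proj₁ (proj₂ e)) (proj₁ (proj₂ f))
      ; fE-surj = λ (g , g∈Q , g∉S) → let (e , e∈B , oe) = edge-surjective⁻ g∈Q g∉S
                                      in (e , e∈B , preimage-off-sphere oe g∉S) , oe
      ; inc     = λ _ _ _ → edge-incidence
      ; inc⁻    = λ e a b → edge-incidence⁻ (proj₂ a) (proj₂ b) (proj₁ (proj₂ e))
      } , vertex-pointed

  module SeparationFromLinks (r : ℕ) where
    open BallCounting r using (Ball; ball-surjective⇒injective)

    private
      o : Pt d
      o = origin d

    record BallBijection (c : Pt d) : Set where
      field
        to            : V (Link (𝕃 d) o r) → V (Link (Quot Γ) c r)
        to-injective  : ∀ {a b} → proj₁ (to a) ∼ proj₁ (to b) → proj₁ a ≡ proj₁ b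
        to-surjective : (y : V (Link (Quot Γ) c r)) → Σ (V (Link (𝕃 d) o r)) λ a → proj₁ (to a) ∼ proj₁ y

    linkIso⇒ballBijection : ∀ {c} → Iso (Link (𝕃 d) o r) (Link (Quot Γ) c r) → BallBijection c
    linkIso⇒ballBijection φ = record
      { to = Iso.fV φ ; to-injective = Iso.fV-inj φ ; to-surjective = Iso.fV-surj φ }

    link⁻Iso⇒ballBijection : ∀ {c} → Iso (Link⁻ (𝕃 d) o r) (Link⁻ (Quot Γ) c r) → BallBijection c
    link⁻Iso⇒ballBijection φ = record
      { to = Iso.fV φ ; to-injective = Iso.fV-inj φ ; to-surjective = Iso.fV-surj φ }

    -- Projection maps the r-ball of 𝕃 around c onto that of the quotient, and the two balls
    -- are equinumerous, so the projection is injective on the ball.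
    ball-injective : ∀ {c} → BallBijection c → ∀ {a b} → dist c a ≤ r → dist c b ≤ r → a ∼ b → a ≡ b
    ball-injective {c} β {a} {b} a∈B b∈B a∼b =
      ⊕-injective (⊖ c) (ball-surjective⇒injective ψ ψ-surjective tₐ t_b (to-injective ψtₐ∼ψt_b))
      where
      open BallBijection β
      open QuotientBalls c r

      centre : ∀ {y} → dist c y ≤ r → dist o (⊖ c ⊕ y) ≤ r
      centre {y} = subst (_≤ r) (sym (dist-⊖ c y))

      preimage : (t : Ball d) → Σ (V (Link (𝕃 d) o r)) λ a → proj₁ (to a) ∼ c ⊕ proj₁ t
      preimage (t , t∈B) = to-surjective (c ⊕ t , dist≤⇒distLeQ (subst (_≤ r) (sym (dist-⊕ʳ c t)) t∈B))

      ψ : Ball d → Pt d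
      ψ t = proj₁ (proj₁ (preimage t))

      to-preimage : ∀ t → proj₁ (to (proj₁ (preimage t))) ∼ c ⊕ proj₁ t
      to-preimage t = proj₂ (preimage t)

      ψ-surjective : (b : Ball d) → Σ (Ball d) λ t → ψ t ≡ proj₁ b
      ψ-surjective (b , b∈B)
        with y , to-b∼y , y∈B ← distLeQ⇒lift (proj₂ (to (b , Equivalence.from distLe⇔dist≤ b∈B)))
        = t , to-injective (∼-trans to-ψt∼y (∼-sym to-b∼y))
        where
        t : Ball d
        t = ⊖ c ⊕ y , centre y∈B
        to-ψt∼y : proj₁ (to (proj₁ (preimage t))) ∼ y
        to-ψt∼y = subst (proj₁ (to (proj₁ (preimage t))) ∼_) (⊕-cancelˡ c y) (to-preimage t)

      tₐ t_b : Ball d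
      tₐ  = ⊖ c ⊕ a , centre a∈B
      t_b = ⊖ c ⊕ b , centre b∈B

      ψtₐ∼ψt_b : proj₁ (to (proj₁ (preimage tₐ))) ∼ proj₁ (to (proj₁ (preimage t_b)))
      ψtₐ∼ψt_b = ∼-trans (to-preimage tₐ) (∼-trans (∼-reflexive (⊕-cancelˡ c a))
                   (∼-trans a∼b (∼-trans (∼-reflexive (sym (⊕-cancelˡ c b))) (∼-sym (to-preimage t_b)))))

    separated-below-2r+1 : (∀ c → BallBijection c) → Separated (2 * r + 1)
    separated-below-2r+1 β {x} {y} {m} x∼y p m<2r+1
      with c , p₁ , p₂ ← splitAt ⌊ m /2⌋ (subst (x ⇝⟨_⟩ y) (sym (ℕP.⌊n/2⌋+⌈n/2⌉≡n m)) p) =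
      ball-injective (β c) (ℕP.≤-trans (dist≤length (reverse p₁)) ⌊m/2⌋≤r)
                           (ℕP.≤-trans (dist≤length p₂) ⌈m/2⌉≤r) x∼y
      where
      m≤r+r : m ≤ r + r
      m≤r+r = subst (m ≤_) (2*n≡n+n r) (m<n+1⇒m≤n (2 * r) m<2r+1)
      ⌊m/2⌋≤r : ⌊ m /2⌋ ≤ r
      ⌊m/2⌋≤r = subst (⌊ m /2⌋ ≤_) (sym (ℕP.n≡⌊n+n/2⌋ r)) (ℕP.⌊n/2⌋-mono m≤r+r)
      ⌈m/2⌉≤r : ⌈ m /2⌉ ≤ r
      ⌈m/2⌉≤r = subst (⌈ m /2⌉ ≤_) (sym (ℕP.n≡⌈n+n/2⌉ r)) (ℕP.⌈n/2⌉-mono m≤r+r)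

    module _ {z y : Pt d} (φ : Iso (Link (𝕃 d) o r) (Link (Quot Γ) z r)) (z∼y : z ∼ y) where
      open QuotientBalls z r

      -- Either the prefix or the suffix has length ≤ r, and y lies in the orbit of z.
      on-short-walk : ∀ {w j m} → z ⇝⟨ j ⟩ w → w ⇝⟨ m ⟩ y → j + m ≤ 2 * r + 1 → DistLe (Quot Γ) z w r
      on-short-walk {j = j} {m} pre suf j+m≤2r+1 with j ≤? r
      ... | yes j≤r = j , j≤r , fromWalkᴵ (project pre)
      ... | no  j≰r = m , m≤r , fromWalkᴵ (qwalk-start (∼-sym z∼y) (project (reverse suf)))
        where
        m≤r : m ≤ r
        m≤r = ℕP.+-cancelˡ-≤ (suc r) m r (begin
          suc r + m  ≤⟨ ℕP.+-monoˡ-≤ m (ℕP.≰⇒> j≰r) ⟩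
          j + m      ≤⟨ j+m≤2r+1 ⟩
          2 * r + 1  ≡⟨ 2r+1≡1+r+r r ⟩
          suc r + r  ∎)
          where
          open ℕP.≤-Reasoning
          2r+1≡1+r+r : ∀ r → 2 * r + 1 ≡ suc r + r
          2r+1≡1+r+r = ℕS.solve-∀

      y∈Q : DistLe (Quot Γ) z y r
      y∈Q = 0 , z≤n , z∼y

      walk-in-link : ∀ {w j m} (pre : z ⇝⟨ j ⟩ w) (suf : w ⇝⟨ m ⟩ y) (bound : j + m ≤ 2 * r + 1) →
                     Walk (Link (Quot Γ) z r) (w , on-short-walk pre suf bound) (y , y∈Q) m
      walk-in-link pre (stop refl) _ = ∼-refl
      walk-in-link {j = j} pre (step {w = u} {n = m} e inc suf) bound =
        (e , incL⇒edgeInBallQ inc (on-short-walk pre (step e inc suf) bound) (on-short-walk pre′ suf bound′)) ,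
        (u , on-short-walk pre′ suf bound′) , incL⇒incQ inc , walk-in-link pre′ suf bound′
        where
        pre′ : z ⇝⟨ suc j ⟩ u
        pre′ = snoc pre inc
        bound′ : suc j + m ≤ 2 * r + 1
        bound′ = subst (_≤ 2 * r + 1) (ℕP.+-suc j m) bound

      pullback : ∀ n {c c′} → Walk (Link (Quot Γ) z r) c c′ n → (a b : V (Link (𝕃 d) o r)) →
                 proj₁ (Iso.fV φ a) ∼ proj₁ c → proj₁ (Iso.fV φ b) ∼ proj₁ c′ → proj₁ a ⇝⟨ n ⟩ proj₁ b
      pullback zero c∼c′ a b a∼c b∼c′ =
        subst (proj₁ a ⇝⟨ 0 ⟩_) (Iso.fV-inj φ (∼-trans a∼c (∼-trans c∼c′ (∼-sym b∼c′)))) (stop refl)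
      pullback (suc n) (e , w , inc , rest) a b a∼c b∼c′
        with w₀ , w₀∼w ← Iso.fV-surj φ w | e₀ , e₀∼e ← Iso.fE-surj φ e =
        step (proj₁ e₀) (Iso.inc⁻ φ e₀ a w₀ inc₀) (pullback n rest w₀ b w₀∼w b∼c′)
        where
        inc₀ : IncQ Γ (proj₁ (Iso.fE φ e₀)) (proj₁ (Iso.fV φ a)) (proj₁ (Iso.fV φ w₀))
        inc₀ = incQ-resp-orbitE (orbitE-sym e₀∼e) (incQ-resp-∼ inc (∼-sym a∼c) (∼-sym w₀∼w))

      no-odd-orbit-walk : ¬ (z ⇝⟨ 2 * r + 1 ⟩ y)
      no-odd-orbit-walk p with a , a∼z ← Iso.fV-surj φ (z , 0 , z≤n , ∼-refl) =
        no-odd-closed-walk r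
          (pullback (2 * r + 1) (walk-in-link (stop refl) p ℕP.≤-refl) a a a∼z (∼-trans a∼z z∼y))

    separated-below-2r+2 : (∀ c → Iso (Link (𝕃 d) o r) (Link (Quot Γ) c r)) → Separated (2 * r + 2)
    separated-below-2r+2 φ {x} {n = m} x∼y p m<2r+2
      with ℕP.m≤n⇒m<n∨m≡n (m<n+1⇒m≤n (2 * r + 1) (subst (m <_) (sym (ℕP.+-assoc (2 * r) 1 1)) m<2r+2))
    ... | inj₁ m<2r+1 = separated-below-2r+1 (linkIso⇒ballBijection ∘ φ) x∼y p m<2r+1
    ... | inj₂ refl   = ⊥-elim (no-odd-orbit-walk (φ x) x∼y p)

lemma5 : (d r : ℕ) → 1 ≤ r → (Γ : Aut d → Set) → IsSubgroup Γ →
         (LocallyL d r (Quot Γ) ⇔ DispGe Γ (2 * r + 2))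
         × (WeaklyLocallyL d r (Quot Γ) ⇔ DispGe Γ (2 * r + 1))
lemma5 d r 1≤r Γ S =
  mk⇔ (λ L → separated⇒dispGe 2<2r+2 (separated-below-2r+2 (proj₁ ∘ L)))
      (λ D v → LinksFromSeparation.link-iso r 2r+1≤2r+2 (dispGe⇒separated D) v ℕP.≤-refl) ,
  mk⇔ (λ L → separated⇒dispGe 2<2r+1 (separated-below-2r+1 (link⁻Iso⇒ballBijection ∘ proj₁ ∘ L)))
      (λ D v → LinksFromSeparation.link⁻-iso r ℕP.≤-refl (dispGe⇒separated D) v)
  where
  open Quotient S
  open SeparationFromLinks r

  2<2r+1 : 2 < 2 * r + 1
  2<2r+1 = ℕP.+-monoˡ-≤ 1 (ℕP.*-monoʳ-≤ 2 1≤r)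

  2r+1≤2r+2 : 2 * r + 1 ≤ 2 * r + 2
  2r+1≤2r+2 = ℕP.+-monoʳ-≤ (2 * r) (s≤s z≤n)

  2<2r+2 : 2 < 2 * r + 2
  2<2r+2 = ℕP.≤-trans 2<2r+1 2r+1≤2r+2
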